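{- The systems $\mathbf{KDC}$, $\mathbf{KC45}$ and $\mathbf{KDC45}$ are complete with respect to their intended semantic classes: $\mathbf{KDC}$ with respect to definedness-preserving, C-propagating Kripke models with serial accessibility; $\mathbf{KC45}$ with respect to such models with transitive and Euclidean accessibility; and $\mathbf{KDC45}$ with respect to such models with serial, transitive and Euclidean accessibility.
   Context: The base logic is paracomplete (e.g. Weak Kleene three-valued logic): a formula at a world may be true, false or undefined. A Kripke model $\mathcal{M}=\langle W,R,\mathcal{V}\rangle$ has a non-empty set of worlds, an accessibility relation $R$, and for each world $w$ a primitive valuation $\mathcal{V}_w\subseteq\mathbb{P}\times\{\top,\bot\}$ (a partial assignment of truth values to primitive propositions), extended compositionally by the base logic; $\mathcal{M},w\vDash\Box\varphi$ iff $\varphi$ holds at all $w'$ with $wRw'$. $R$ is definedness-preserving if $wRw'$ implies $\mathcal{V}_w\subseteq\mathcal{V}_{w'}$. The model is C-propagating if every formula that is defined (true or false) and true at $w$ is true at all $R$-successors of $w$. $\mathbf{KC}$ consists of all base-logic tautologies, axiom K: $\Box(\varphi\to\psi)\to(\Box\varphi\to\Box\psi)$, axiom C: $\varphi\to\Box\varphi$, modus ponens and necessitation. $\mathbf{KDC}$ adds axiom D: $\Box\varphi\to\neg\Box\neg\varphi$; $\mathbf{KC45}$ adds axioms 4: $\Box\varphi\to\Box\Box\varphi$ and 5: $\neg\Box\varphi\to\Box\neg\Box\varphi$; $\mathbf{KDC45}$ adds D, 4 and 5. -}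

module Defs where

open import Data.Nat using (ℕ)
open import Data.Product using (Σ; _×_; ∃)
open import Data.Sum using (_⊎_)
open import Data.Empty using (⊥)
open import Relation.Nullary using (¬_)
open import Relation.Binary.PropositionalEquality using (_≡_; _≢_)

data V3 : Set where
  tt ff un : V3

wk¬ : V3 → V3
wk¬ tt = ff
wk¬ ff = tt
wk¬ un = un

wk∧ : V3 → V3 → V3
wk∧ un _  = un
wk∧ _  un = un
wk∧ tt tt = tt
wk∧ tt ff = ff
wk∧ ff tt = ff
wk∧ ff ff = ff

wk∨ : V3 → V3 → V3
wk∨ un _  = un
wk∨ _  un = un
wk∨ ff ff = ff
wk∨ tt tt = tt
wk∨ tt ff = tt
wk∨ ff tt = tt

wk⇒ : V3 → V3 → V3
wk⇒ un _  = un
wk⇒ _  un = un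
wk⇒ tt ff = ff
wk⇒ tt tt = tt
wk⇒ ff tt = tt
wk⇒ ff ff = tt

Prop : Set
Prop = ℕ

infixr 5 _⇒_
infixr 6 _∨_
infixr 7 _∧_

data Form : Set where
  atom : Prop → Form
  ∼_   : Form → Form
  _∧_  : Form → Form → Form
  _∨_  : Form → Form → Form
  _⇒_  : Form → Form → Form
  □_   : Form → Form

evalB : (Form → V3) → Form → V3
evalB f (atom p) = f (atom p)
evalB f (∼ φ)    = wk¬ (evalB f φ)
evalB f (φ ∧ ψ)  = wk∧ (evalB f φ) (evalB f ψ)
evalB f (φ ∨ ψ)  = wk∨ (evalB f φ) (evalB f ψ)
evalB f (φ ⇒ ψ)  = wk⇒ (evalB f φ) (evalB f ψ)
evalB f (□ φ)    = f (□ φ)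

BaseTaut : Form → Set
BaseTaut φ = (f : Form → V3) → evalB f φ ≢ un → evalB f φ ≡ tt

data Ax-D : Form → Set where
  inst : (φ : Form) → Ax-D (□ φ ⇒ ∼ □ (∼ φ))

data Ax-4 : Form → Set where
  inst : (φ : Form) → Ax-4 (□ φ ⇒ □ □ φ)

data Ax-5 : Form → Set where
  inst : (φ : Form) → Ax-5 (∼ □ φ ⇒ □ ∼ □ φ)

data _⊢_ (Extra : Form → Set) : Form → Set where
  taut  : ∀ {φ} → BaseTaut φ → Extra ⊢ φ
  axK   : ∀ φ ψ → Extra ⊢ (□ (φ ⇒ ψ) ⇒ (□ φ ⇒ □ ψ))
  axC   : ∀ φ → Extra ⊢ (φ ⇒ □ φ)
  extra : ∀ {φ} → Extra φ → Extra ⊢ φ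
  mp    : ∀ {φ ψ} → Extra ⊢ (φ ⇒ ψ) → Extra ⊢ φ → Extra ⊢ ψ
  nec   : ∀ {φ} → Extra ⊢ φ → Extra ⊢ (□ φ)

KDC-ax : Form → Set
KDC-ax = Ax-D

KC45-ax : Form → Set
KC45-ax φ = Ax-4 φ ⊎ Ax-5 φ

KDC45-ax : Form → Set
KDC45-ax φ = Ax-D φ ⊎ (Ax-4 φ ⊎ Ax-5 φ)

record Model : Set₁ where
  field
    W     : Set
    R     : W → W → Set
    V     : W → Prop → V3
    world : W                 -- W is non-empty

module _ (M : Model) where
  open Model M

  Def  : W → Form → Set
  True : W → Form → Set

  Def w (atom p) = V w p ≢ un
  Def w (∼ φ)    = Def w φ
  Def w (φ ∧ ψ)  = Def w φ × Def w ψ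
  Def w (φ ∨ ψ)  = Def w φ × Def w ψ
  Def w (φ ⇒ ψ)  = Def w φ × Def w ψ
  Def w (□ φ)    = Def w φ

  True w (atom p) = V w p ≡ tt
  True w (∼ φ)    = Def w φ × ¬ True w φ
  True w (φ ∧ ψ)  = True w φ × True w ψ
  True w (φ ∨ ψ)  = Def w φ × Def w ψ × (True w φ ⊎ True w ψ)
  True w (φ ⇒ ψ)  = Def w φ × Def w ψ × (True w φ → True w ψ)
  True w (□ φ)    = Def w φ × (∀ v → R w v → True v φ)

  DefinednessPreserving : Set
  DefinednessPreserving = ∀ w v p b → R w v → V w p ≡ b → b ≢ un → V v p ≡ b

  CPropagating : Set
  CPropagating = ∀ w v φ → R w v → Def w φ → True w φ → True v φ

  Serial : Set
  Serial = ∀ w → ∃ λ v → R w v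

  Transitive : Set
  Transitive = ∀ u v w → R u v → R v w → R u w

  Euclidean : Set
  Euclidean = ∀ u v w → R u v → R u w → R v w

Valid : (Model → Set) → Form → Set₁
Valid C φ = (M : Model) → C M → (w : Model.W M) → Def M w φ → True M w φ

BaseClass : Model → Set
BaseClass M = DefinednessPreserving M × CPropagating M

KDC-class : Model → Set
KDC-class M = BaseClass M × Serial M

KC45-class : Model → Set
KC45-class M = BaseClass M × (Transitive M × Euclidean M)

KDC45-class : Model → Set
KDC45-class M = BaseClass M × (Serial M × (Transitive M × Euclidean M))

-- Axiom C makes every true formula persist along R, so boxes collapse: where
-- ∼ □ ⊥ holds (in particular under D) □ ψ is equivalent to ψ, and where □ ⊥
-- holds every □ ψ with ψ defined is true.  Hence a valuation of the
-- propositional leaves (atoms and boxed formulas) that satisfies these derivable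
-- collapse principles for the boxed subformulas of φ is realised by a one-world
-- model: a reflexive point, or a dead end, where □ ψ is true exactly when ψ is
-- defined.  These models lie in the relevant classes (the dead end only when
-- seriality is not required), so a valid φ is a Weak Kleene consequence of
-- derivable formulas, and therefore derivable.
module Submission where

open import Defs
open import Data.Empty using (⊥; ⊥-elim)
open import Data.Fin using (Fin)
open import Data.Fin.Patterns using (0F; 1F; 2F; 3F; 4F)
open import Data.List using (List; []; _∷_; _++_; concatMap)
open import Data.List.Relation.Unary.All as All using (All; []; _∷_)
open import Data.List.Relation.Unary.All.Properties
  using (++⁻ˡ; ++⁻ʳ; concat⁺; concat⁻; map⁺; map⁻)
open import Data.Nat using (ℕ; zero; suc)
open import Data.Product using (Σ; _×_; _,_; proj₁; proj₂)
open import Data.Sum using (_⊎_; inj₁; inj₂)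
open import Data.Unit using (⊤) renaming (tt to ⋆)
open import Data.Vec as Vec using (Vec; []; _∷_; lookup)
open import Data.Vec.Properties using (lookup-map)
open import Relation.Nullary using (¬_)
open import Relation.Binary.PropositionalEquality
  using (_≡_; _≢_; refl; sym; cong; cong₂; subst)

private
  variable
    n : ℕ
    E : Form → Set

⇒-defined : ∀ a b → wk⇒ a b ≢ un → b ≢ un
⇒-defined tt un d = ⊥-elim (d refl)
⇒-defined ff un d = ⊥-elim (d refl)
⇒-defined un _  d = ⊥-elim (d refl)
⇒-defined _  tt _ = λ ()
⇒-defined _  ff _ = λ ()

⇒-true-antecedent-defined : ∀ a b → wk⇒ a b ≡ tt → a ≢ un
⇒-true-antecedent-defined tt _ _ = λ ()
⇒-true-antecedent-defined ff _ _ = λ ()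

⇒-intro : ∀ a b → wk⇒ a b ≢ un → (a ≡ tt → b ≡ tt) → wk⇒ a b ≡ tt
⇒-intro tt tt _ _ = refl
⇒-intro tt ff _ h with h refl
... | ()
⇒-intro ff tt _ _ = refl
⇒-intro ff ff _ _ = refl
⇒-intro tt un d _ = ⊥-elim (d refl)
⇒-intro ff un d _ = ⊥-elim (d refl)
⇒-intro un _  d _ = ⊥-elim (d refl)

⇒-mp : ∀ a b → wk⇒ a b ≡ tt → a ≡ tt → b ≡ tt
⇒-mp tt tt _ _ = refl

⇒-antisym : ∀ a b → wk⇒ a b ≡ tt → wk⇒ b a ≡ tt → a ≡ b
⇒-antisym tt tt _ _ = refl
⇒-antisym ff ff _ _ = refl

∨-excluded-middle : ∀ a → wk∨ a (wk¬ a) ≡ tt → a ≡ tt ⊎ a ≡ ff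
∨-excluded-middle tt _ = inj₁ refl
∨-excluded-middle ff _ = inj₂ refl

infixr 5 _⇒_
infixr 6 _∨_
infixr 7 _∧_

data Schema (n : ℕ) : Set where
  var         : Fin n → Schema n
  ∼_          : Schema n → Schema n
  _∧_ _∨_ _⇒_ : Schema n → Schema n → Schema n

_⟨_⟩ : Schema n → Vec Form n → Form
var i   ⟨ σ ⟩ = lookup σ i
(∼ s)   ⟨ σ ⟩ = ∼ (s ⟨ σ ⟩)
(s ∧ t) ⟨ σ ⟩ = s ⟨ σ ⟩ ∧ t ⟨ σ ⟩
(s ∨ t) ⟨ σ ⟩ = s ⟨ σ ⟩ ∨ t ⟨ σ ⟩
(s ⇒ t) ⟨ σ ⟩ = s ⟨ σ ⟩ ⇒ t ⟨ σ ⟩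

⟦_⟧ : Schema n → Vec V3 n → V3
⟦ var i ⟧ ρ = lookup ρ i
⟦ ∼ s   ⟧ ρ = wk¬ (⟦ s ⟧ ρ)
⟦ s ∧ t ⟧ ρ = wk∧ (⟦ s ⟧ ρ) (⟦ t ⟧ ρ)
⟦ s ∨ t ⟧ ρ = wk∨ (⟦ s ⟧ ρ) (⟦ t ⟧ ρ)
⟦ s ⇒ t ⟧ ρ = wk⇒ (⟦ s ⟧ ρ) (⟦ t ⟧ ρ)

evalB-⟨⟩ : ∀ f (s : Schema n) σ → evalB f (s ⟨ σ ⟩) ≡ ⟦ s ⟧ (Vec.map (evalB f) σ)
evalB-⟨⟩ f (var i) σ = sym (lookup-map i (evalB f) σ)
evalB-⟨⟩ f (∼ s)   σ = cong wk¬ (evalB-⟨⟩ f s σ)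
evalB-⟨⟩ f (s ∧ t) σ = cong₂ wk∧ (evalB-⟨⟩ f s σ) (evalB-⟨⟩ f t σ)
evalB-⟨⟩ f (s ∨ t) σ = cong₂ wk∨ (evalB-⟨⟩ f s σ) (evalB-⟨⟩ f t σ)
evalB-⟨⟩ f (s ⇒ t) σ = cong₂ wk⇒ (evalB-⟨⟩ f s σ) (evalB-⟨⟩ f t σ)

ForAllValuations : ∀ n → (Vec V3 n → Set) → Set
ForAllValuations zero    P = P []
ForAllValuations (suc n) P = ForAllValuations n (λ ρ → P (tt ∷ ρ))
                           × ForAllValuations n (λ ρ → P (ff ∷ ρ))
                           × ForAllValuations n (λ ρ → P (un ∷ ρ))

forAllValuations : ∀ n (P : Vec V3 n → Set) → ForAllValuations n P → ∀ ρ → P ρ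
forAllValuations zero    P p           []       = p
forAllValuations (suc n) P (p , _ , _) (tt ∷ ρ) = forAllValuations n _ p ρ
forAllValuations (suc n) P (_ , p , _) (ff ∷ ρ) = forAllValuations n _ p ρ
forAllValuations (suc n) P (_ , _ , p) (un ∷ ρ) = forAllValuations n _ p ρ

-- Defined by cases rather than as '≢ ff' so that on a closed schema the
-- truth-table check normalises to a product of ⊤ and is discharged by '_'.
NotFalse : V3 → Set
NotFalse ff = ⊥
NotFalse _  = ⊤

IsTautology : Schema n → Set
IsTautology {n} s = ForAllValuations n (λ ρ → NotFalse (⟦ s ⟧ ρ))

notFalse-defined⇒tt : ∀ v → NotFalse v → v ≢ un → v ≡ tt
notFalse-defined⇒tt tt _ _ = refl
notFalse-defined⇒tt un _ d = ⊥-elim (d refl)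

tautology : (s : Schema n) → IsTautology s → ∀ σ → BaseTaut (s ⟨ σ ⟩)
tautology {n} s check σ f =
  notFalse-defined⇒tt (evalB f (s ⟨ σ ⟩))
    (subst NotFalse (sym (evalB-⟨⟩ f s σ))
      (forAllValuations n _ check (Vec.map (evalB f) σ)))

Holds : (Form → V3) → Form → Set
Holds f γ = evalB f γ ≡ tt

_⊨_ : List Form → Form → Set
Γ ⊨ φ = ∀ f → All (Holds f) Γ → evalB f φ ≢ un → Holds f φ

⊨-⇒-intro : ∀ {γ Γ φ} → (γ ∷ Γ) ⊨ φ → Γ ⊨ (γ ⇒ φ)
⊨-⇒-intro {γ} {φ = φ} Γ⊨φ f Γ-true defined =
  ⇒-intro (evalB f γ) (evalB f φ) defined
    (λ γ-true → Γ⊨φ f (γ-true ∷ Γ-true) (⇒-defined (evalB f γ) (evalB f φ) defined))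

⊨⇒⊢ : ∀ {Γ φ} → All (E ⊢_) Γ → Γ ⊨ φ → E ⊢ φ
⊨⇒⊢ []          Γ⊨φ = taut (λ f → Γ⊨φ f [])
⊨⇒⊢ {φ = φ} (⊢γ ∷ ⊢Γ) Γ⊨φ = mp (⊨⇒⊢ ⊢Γ (⊨-⇒-intro {φ = φ} Γ⊨φ)) ⊢γ

⊥ᶠ : Form
⊥ᶠ = atom 0 ∧ ∼ atom 0

-- If ψ failed, C would give □ ∼ ψ, contradicting D.
D⇒T : (∀ ψ → E ⊢ (□ ψ ⇒ ∼ □ (∼ ψ))) → ∀ ψ → E ⊢ (□ ψ ⇒ ψ)
D⇒T D ψ = mp (mp (taut (tautology schema _ (□ ψ ∷ □ (∼ ψ) ∷ ψ ∷ []))) (D ψ)) (axC (∼ ψ))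
  where
  schema : Schema 3
  schema = (var 0F ⇒ ∼ var 1F) ⇒ (∼ var 2F ⇒ var 1F) ⇒ (var 0F ⇒ var 2F)

□⊥⇒□ : ∀ ψ → E ⊢ (□ ⊥ᶠ ⇒ □ ψ)
□⊥⇒□ ψ = mp (axK ⊥ᶠ ψ) (nec (taut (tautology explosion _ (atom 0 ∷ ψ ∷ []))))
  where
  explosion : Schema 2
  explosion = (var 0F ∧ ∼ var 0F) ⇒ var 1F

-- If ψ failed, C would give □ ∼ ψ, and K turns □ ψ and □ ∼ ψ into □ ⊥ᶠ.
∼□⊥⇒T : ∀ ψ → E ⊢ (∼ □ ⊥ᶠ ⇒ □ ψ ⇒ ψ)
∼□⊥⇒T ψ = mp (mp (mp (taut (tautology schema _ σ)) □ψ⇒□[∼ψ⇒⊥]) (axK (∼ ψ) ⊥ᶠ)) (axC (∼ ψ))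
  where
  σ : Vec Form 5
  σ = □ ψ ∷ □ (∼ ψ ⇒ ⊥ᶠ) ∷ □ (∼ ψ) ∷ □ ⊥ᶠ ∷ ψ ∷ []

  schema : Schema 5
  schema = (var 0F ⇒ var 1F) ⇒ (var 1F ⇒ var 2F ⇒ var 3F) ⇒ (∼ var 4F ⇒ var 2F)
         ⇒ ∼ var 3F ⇒ var 0F ⇒ var 4F

  noncontradiction : Schema 2
  noncontradiction = var 0F ⇒ ∼ var 0F ⇒ (var 1F ∧ ∼ var 1F)

  □ψ⇒□[∼ψ⇒⊥] : E ⊢ (□ ψ ⇒ □ (∼ ψ ⇒ ⊥ᶠ))
  □ψ⇒□[∼ψ⇒⊥] = mp (axK ψ (∼ ψ ⇒ ⊥ᶠ))
                    (nec (taut (tautology noncontradiction _ (ψ ∷ atom 0 ∷ []))))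

□⊥-excluded-middle : E ⊢ (□ ⊥ᶠ ∨ ∼ □ ⊥ᶠ)
□⊥-excluded-middle = taut (tautology (var 0F ∨ ∼ var 0F) _ (□ ⊥ᶠ ∷ []))

module _ (M : Model) where
  open Model M

  HasValue : W → Form → V3 → Set
  HasValue w φ tt = Def M w φ × True M w φ
  HasValue w φ ff = Def M w φ × ¬ True M w φ
  HasValue w φ un = ¬ Def M w φ

  module _ {w : W} where
    hasValue-atom : ∀ {p v} → V w p ≡ v → HasValue w (atom p) v
    hasValue-atom {v = tt} eq rewrite eq = (λ ()) , refl
    hasValue-atom {v = ff} eq rewrite eq = (λ ()) , (λ ())
    hasValue-atom {v = un} eq = λ defined → defined eq

    hasValue-∼ : ∀ {φ x} → HasValue w φ x → HasValue w (∼ φ) (wk¬ x)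
    hasValue-∼ {x = tt} (d , t) = d , λ (_ , ¬t) → ¬t t
    hasValue-∼ {x = ff} (d , ¬t) = d , (d , ¬t)
    hasValue-∼ {x = un} ¬d = ¬d

    hasValue-∧ : ∀ {φ ψ x y} → HasValue w φ x → HasValue w ψ y → HasValue w (φ ∧ ψ) (wk∧ x y)
    hasValue-∧ {x = tt} {tt} (dφ , tφ) (dψ , tψ) = (dφ , dψ) , (tφ , tψ)
    hasValue-∧ {x = tt} {ff} (dφ , _)  (dψ , ¬tψ) = (dφ , dψ) , λ t → ¬tψ (proj₂ t)
    hasValue-∧ {x = ff} {tt} (dφ , ¬tφ) (dψ , _) = (dφ , dψ) , λ t → ¬tφ (proj₁ t)
    hasValue-∧ {x = ff} {ff} (dφ , ¬tφ) (dψ , _) = (dφ , dψ) , λ t → ¬tφ (proj₁ t)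
    hasValue-∧ {x = tt} {un} _ ¬dψ = λ d → ¬dψ (proj₂ d)
    hasValue-∧ {x = ff} {un} _ ¬dψ = λ d → ¬dψ (proj₂ d)
    hasValue-∧ {x = un}      ¬dφ _ = λ d → ¬dφ (proj₁ d)

    hasValue-∨ : ∀ {φ ψ x y} → HasValue w φ x → HasValue w ψ y → HasValue w (φ ∨ ψ) (wk∨ x y)
    hasValue-∨ {x = tt} {tt} (dφ , tφ) (dψ , _) = (dφ , dψ) , (dφ , dψ , inj₁ tφ)
    hasValue-∨ {x = tt} {ff} (dφ , tφ) (dψ , _) = (dφ , dψ) , (dφ , dψ , inj₁ tφ)
    hasValue-∨ {x = ff} {tt} (dφ , _) (dψ , tψ) = (dφ , dψ) , (dφ , dψ , inj₂ tψ)
    hasValue-∨ {x = ff} {ff} (dφ , ¬tφ) (dψ , ¬tψ) =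
      (dφ , dψ) , λ { (_ , _ , inj₁ tφ) → ¬tφ tφ ; (_ , _ , inj₂ tψ) → ¬tψ tψ }
    hasValue-∨ {x = tt} {un} _ ¬dψ = λ d → ¬dψ (proj₂ d)
    hasValue-∨ {x = ff} {un} _ ¬dψ = λ d → ¬dψ (proj₂ d)
    hasValue-∨ {x = un}      ¬dφ _ = λ d → ¬dφ (proj₁ d)

    hasValue-⇒ : ∀ {φ ψ x y} → HasValue w φ x → HasValue w ψ y → HasValue w (φ ⇒ ψ) (wk⇒ x y)
    hasValue-⇒ {x = tt} {tt} (dφ , _) (dψ , tψ) = (dφ , dψ) , (dφ , dψ , λ _ → tψ)
    hasValue-⇒ {x = tt} {ff} (dφ , tφ) (dψ , ¬tψ) = (dφ , dψ) , λ (_ , _ , φ→ψ) → ¬tψ (φ→ψ tφ)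
    hasValue-⇒ {x = ff} {tt} (dφ , _) (dψ , tψ) = (dφ , dψ) , (dφ , dψ , λ _ → tψ)
    hasValue-⇒ {x = ff} {ff} (dφ , ¬tφ) (dψ , _) = (dφ , dψ) , (dφ , dψ , λ tφ → ⊥-elim (¬tφ tφ))
    hasValue-⇒ {x = tt} {un} _ ¬dψ = λ d → ¬dψ (proj₂ d)
    hasValue-⇒ {x = ff} {un} _ ¬dψ = λ d → ¬dψ (proj₂ d)
    hasValue-⇒ {x = un}      ¬dφ _ = λ d → ¬dφ (proj₁ d)

    hasValue-valid : ∀ {φ x} → HasValue w φ x → x ≢ un → (Def M w φ → True M w φ) → x ≡ tt
    hasValue-valid {x = tt} _ _ _ = refl
    hasValue-valid {x = ff} (d , ¬t) _ valid = ⊥-elim (¬t (valid d))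
    hasValue-valid {x = un} _ defined _ = ⊥-elim (defined refl)

  BoxStep : W → (Form → V3) → Form → Set
  BoxStep w f ψ = HasValue w ψ (evalB f ψ) → HasValue w (□ ψ) (f (□ ψ))

boxed : Form → List Form
boxed (atom p) = []
boxed (∼ φ)    = boxed φ
boxed (φ ∧ ψ)  = boxed φ ++ boxed ψ
boxed (φ ∨ ψ)  = boxed φ ++ boxed ψ
boxed (φ ⇒ ψ)  = boxed φ ++ boxed ψ
boxed (□ φ)    = φ ∷ boxed φ

truth-lemma : ∀ M w f → (∀ p → Model.V M w p ≡ f (atom p)) →
             ∀ φ → All (BoxStep M w f) (boxed φ) → HasValue M w φ (evalB f φ)
truth-lemma M w f atoms = go
  where
  go : ∀ φ → All (BoxStep M w f) (boxed φ) → HasValue M w φ (evalB f φ)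
  go (atom p) _ = hasValue-atom M (atoms p)
  go (∼ φ)   s = hasValue-∼ M (go φ s)
  go (φ ∧ ψ) s = hasValue-∧ M (go φ (++⁻ˡ (boxed φ) s)) (go ψ (++⁻ʳ (boxed φ) s))
  go (φ ∨ ψ) s = hasValue-∨ M (go φ (++⁻ˡ (boxed φ) s)) (go ψ (++⁻ʳ (boxed φ) s))
  go (φ ⇒ ψ) s = hasValue-⇒ M (go φ (++⁻ˡ (boxed φ) s)) (go ψ (++⁻ʳ (boxed φ) s))
  go (□ φ) (step ∷ s) = step (go φ s)

reflexivePoint : (Form → V3) → Model
reflexivePoint f = record { W = ⊤ ; R = λ _ _ → ⊤ ; V = λ _ p → f (atom p) ; world = ⋆ }

deadEnd : (Form → V3) → Model
deadEnd f = record { W = ⊤ ; R = λ _ _ → ⊥ ; V = λ _ p → f (atom p) ; world = ⋆ }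

reflexivePoint-□ : ∀ f {ψ x} → HasValue (reflexivePoint f) ⋆ ψ x →
                   HasValue (reflexivePoint f) ⋆ (□ ψ) x
reflexivePoint-□ f {x = tt} (d , t) = d , (d , λ _ _ → t)
reflexivePoint-□ f {x = ff} (d , ¬t) = d , λ (_ , □t) → ¬t (□t ⋆ ⋆)
reflexivePoint-□ f {x = un} ¬d = ¬d

deadEnd-□ : ∀ f {ψ x} → HasValue (deadEnd f) ⋆ ψ x → x ≢ un →
            HasValue (deadEnd f) ⋆ (□ ψ) tt
deadEnd-□ f {x = tt} (d , _) _ = d , (d , λ _ ())
deadEnd-□ f {x = ff} (d , _) _ = d , (d , λ _ ())
deadEnd-□ f {x = un} _ defined = ⊥-elim (defined refl)

reflexivePoint-boxStep : ∀ f ψ → f (□ ψ) ≡ evalB f ψ → BoxStep (reflexivePoint f) ⋆ f ψ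
reflexivePoint-boxStep f ψ eq h =
  subst (HasValue (reflexivePoint f) ⋆ (□ ψ)) (sym eq) (reflexivePoint-□ f h)

deadEnd-boxStep : ∀ f ψ → f (□ ψ) ≡ tt → evalB f ψ ≢ un → BoxStep (deadEnd f) ⋆ f ψ
deadEnd-boxStep f ψ eq defined h =
  subst (HasValue (deadEnd f) ⋆ (□ ψ)) (sym eq) (deadEnd-□ f h defined)

reflexivePoint∈BaseClass : ∀ f → BaseClass (reflexivePoint f)
reflexivePoint∈BaseClass f = (λ _ _ _ _ _ eq _ → eq) , (λ _ _ _ _ _ t → t)

reflexivePoint∈KDC-class : ∀ f → KDC-class (reflexivePoint f)
reflexivePoint∈KDC-class f = reflexivePoint∈BaseClass f , (λ _ → ⋆ , ⋆)

reflexivePoint∈KC45-class : ∀ f → KC45-class (reflexivePoint f)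
reflexivePoint∈KC45-class f = reflexivePoint∈BaseClass f , ((λ _ _ _ _ _ → ⋆) , (λ _ _ _ _ _ → ⋆))

reflexivePoint∈KDC45-class : ∀ f → KDC45-class (reflexivePoint f)
reflexivePoint∈KDC45-class f =
  reflexivePoint∈BaseClass f , ((λ _ → ⋆ , ⋆) , ((λ _ _ _ _ _ → ⋆) , (λ _ _ _ _ _ → ⋆)))

deadEnd∈KC45-class : ∀ f → KC45-class (deadEnd f)
deadEnd∈KC45-class f = ((λ _ _ _ _ _ eq _ → eq) , (λ _ _ _ ())) , ((λ _ _ _ ()) , (λ _ _ _ ()))

Realises : (Model → Set) → (Form → V3) → Form → Set₁
Realises C f φ = Σ Model λ M → C M × Σ (Model.W M) λ w → HasValue M w φ (evalB f φ)

complete-by-realisation : ∀ {C φ} Γ → All (E ⊢_) Γ →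
                          (∀ f → All (Holds f) Γ → Realises C f φ) →
                          Valid C φ → E ⊢ φ
complete-by-realisation Γ ⊢Γ realise valid = ⊨⇒⊢ ⊢Γ λ f Γ-true defined →
  let M , M∈C , w , hasValue = realise f Γ-true
  in  hasValue-valid M hasValue defined (valid M M∈C w)

reflexiveAxioms : Form → List Form
reflexiveAxioms ψ = (□ ψ ⇒ ψ) ∷ (ψ ⇒ □ ψ) ∷ []

reflexiveAxioms-collapse : ∀ f ψ → All (Holds f) (reflexiveAxioms ψ) → f (□ ψ) ≡ evalB f ψ
reflexiveAxioms-collapse f ψ (T ∷ C ∷ []) = ⇒-antisym (f (□ ψ)) (evalB f ψ) T C

complete-for-reflexivePoints : ∀ {C} → (∀ f → C (reflexivePoint f)) →
                               (∀ ψ → E ⊢ (□ ψ ⇒ ∼ □ (∼ ψ))) →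
                               ∀ φ → Valid C φ → E ⊢ φ
complete-for-reflexivePoints {E = E} {C = C} inC D φ =
  complete-by-realisation (concatMap reflexiveAxioms (boxed φ)) ⊢axioms realise
  where
  ⊢axioms : All (E ⊢_) (concatMap reflexiveAxioms (boxed φ))
  ⊢axioms = concat⁺ (map⁺ (All.universal (λ ψ → D⇒T D ψ ∷ axC ψ ∷ []) (boxed φ)))

  realise : ∀ f → All (Holds f) (concatMap reflexiveAxioms (boxed φ)) → Realises C f φ
  realise f axioms = reflexivePoint f , inC f , ⋆ , truth-lemma _ ⋆ f (λ _ → refl) φ
    (All.map (λ {ψ} ax → reflexivePoint-boxStep f ψ (reflexiveAxioms-collapse f ψ ax))
             (map⁻ (concat⁻ axioms)))

liveOrDeadAxioms : Form → List Form
liveOrDeadAxioms ψ = (ψ ⇒ □ ψ) ∷ (□ ⊥ᶠ ⇒ □ ψ) ∷ (∼ □ ⊥ᶠ ⇒ □ ψ ⇒ ψ) ∷ []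

liveOrDeadAxioms-dead : ∀ f ψ → f (□ ⊥ᶠ) ≡ tt → All (Holds f) (liveOrDeadAxioms ψ) →
                   f (□ ψ) ≡ tt × evalB f ψ ≢ un
liveOrDeadAxioms-dead f ψ dead (C ∷ dead⇒□ψ ∷ _) =
  ⇒-mp (f (□ ⊥ᶠ)) (f (□ ψ)) dead⇒□ψ dead , ⇒-true-antecedent-defined (evalB f ψ) (f (□ ψ)) C

liveOrDeadAxioms-live : ∀ f ψ → f (□ ⊥ᶠ) ≡ ff → All (Holds f) (liveOrDeadAxioms ψ) →
                   f (□ ψ) ≡ evalB f ψ
liveOrDeadAxioms-live f ψ live (C ∷ _ ∷ live⇒T ∷ []) =
  ⇒-antisym (f (□ ψ)) (evalB f ψ) (⇒-mp (wk¬ (f (□ ⊥ᶠ))) _ live⇒T (cong wk¬ live)) C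

complete-for-reflexivePoints-and-deadEnds : ∀ {C} → (∀ f → C (reflexivePoint f)) →
                                            (∀ f → C (deadEnd f)) →
                                            ∀ φ → Valid C φ → E ⊢ φ
complete-for-reflexivePoints-and-deadEnds {E = E} {C = C} reflexive∈C deadEnd∈C φ =
  complete-by-realisation Γ (□⊥-excluded-middle ∷ ⊢axioms) realise
  where
  Γ : List Form
  Γ = (□ ⊥ᶠ ∨ ∼ □ ⊥ᶠ) ∷ concatMap liveOrDeadAxioms (boxed φ)

  ⊢axioms : All (E ⊢_) (concatMap liveOrDeadAxioms (boxed φ))
  ⊢axioms = concat⁺ (map⁺ (All.universal (λ ψ → axC ψ ∷ □⊥⇒□ ψ ∷ ∼□⊥⇒T ψ ∷ []) (boxed φ)))

  realise : ∀ f → All (Holds f) Γ → Realises C f φ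
  realise f (lem ∷ axioms) with ∨-excluded-middle (f (□ ⊥ᶠ)) lem
  ... | inj₁ dead = deadEnd f , deadEnd∈C f , ⋆ , truth-lemma _ ⋆ f (λ _ → refl) φ
    (All.map (λ {ψ} ax → let □ψ , defined = liveOrDeadAxioms-dead f ψ dead ax
                         in deadEnd-boxStep f ψ □ψ defined)
             (map⁻ (concat⁻ axioms)))
  ... | inj₂ live = reflexivePoint f , reflexive∈C f , ⋆ , truth-lemma _ ⋆ f (λ _ → refl) φ
    (All.map (λ {ψ} ax → reflexivePoint-boxStep f ψ (liveOrDeadAxioms-live f ψ live ax))
             (map⁻ (concat⁻ axioms)))

mainTheorem4 : ((φ : Form) → Valid KDC-class φ → KDC-ax ⊢ φ)
             × (((φ : Form) → Valid KC45-class φ → KC45-ax ⊢ φ)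
             × ((φ : Form) → Valid KDC45-class φ → KDC45-ax ⊢ φ))
mainTheorem4 =
    complete-for-reflexivePoints reflexivePoint∈KDC-class (λ ψ → extra (inst ψ))
  , complete-for-reflexivePoints-and-deadEnds reflexivePoint∈KC45-class deadEnd∈KC45-class
  , complete-for-reflexivePoints reflexivePoint∈KDC45-class (λ ψ → extra (inj₁ (inst ψ)))
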